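{- Let $\pi\in\mathcal{S}_n$. If $\pi^2$ has exactly one descent, located at position $i$, then $\pi^2_i\geq \pi^2_{i+1}+2$, where $\pi^2_j$ denotes $\pi^2(j)$.
   Context: $\mathcal{S}_n$ is the symmetric group on $[n]$; a permutation $\sigma=\sigma_1\cdots\sigma_n$ (one-line notation) has a descent at position $i\in[n-1]$ if $\sigma_i>\sigma_{i+1}$. $\pi^2(j)=\pi(\pi(j))$. -}

module Defs where

open import Data.Nat using (ℕ; suc; _<_; _>_)
open import Data.Fin using (Fin; toℕ; fromℕ<)
open import Data.Fin.Permutation using (Permutation′; _⟨$⟩ʳ_; _∘ₚ_)
open import Data.Product using (Σ; ∃; _×_)
open import Relation.Binary.PropositionalEquality using (_≡_)

-- Permutations of [n] are modelled as bijections Fin n → Fin n;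
-- the value σ(j) is (σ ⟨$⟩ʳ j), position/value j ∈ Fin n stands for j+1 ∈ [n].

square : ∀ {n} → Permutation′ n → Permutation′ n
square π = π ∘ₚ π

val : ∀ {n} → Permutation′ n → (i : ℕ) → i < n → ℕ
val σ i i<n = toℕ (σ ⟨$⟩ʳ fromℕ< i<n)

-- σ has a descent at (0-indexed) position i, i.e. 1-indexed position i+1 ∈ [n-1]:
-- i+1 < n and σ(i) > σ(i+1).
HasDescentAt : ∀ {n} → Permutation′ n → ℕ → Set
HasDescentAt {n} σ i =
  Σ (suc i < n) λ h → val σ i (Data.Nat.Properties.<-trans (Data.Nat.Properties.n<1+n i) h) > val σ (suc i) h
  where import Data.Nat.Properties

UniqueDescentAt : ∀ {n} → Permutation′ n → ℕ → Set
UniqueDescentAt σ i = HasDescentAt σ i × (∀ j → HasDescentAt σ j → j ≡ i)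

{-# OPTIONS --safe #-}
-- If the descent of π² drops by exactly one, π²(i) = a + 1 and π²(i+1) = a, then exchanging
-- the values a and a + 1 turns π² into a strictly increasing self-map of [n], i.e. the identity;
-- so π² is the adjacent transposition (i i+1). But no square is a transposition: π commutes
-- with π², so π(i), which is neither i nor π²(i), would be fixed by π², and then so would i.
module Submission where

open import Defs
open import Data.Nat
  using (ℕ; zero; suc; _+_; _∸_; _<_; _≤_; _≥_; z≤n; z<s; s<s; s<s⁻¹; _≟_)
open import Data.Nat.Properties
  using (<-trans; <⇒≤; n<1+n; <-irrelevant; <-cmp; <-asym; ≤-reflexive; ≤-antisym; ≤-<-trans;
         <-≤-trans; m<1+n⇒m≤n; m≤n+m; +-suc; +-comm; m∸n+n≡m; m≤n⇒m<n∨m≡n; 1+n≢n)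
open import Data.Fin using (Fin; toℕ; fromℕ<)
open import Data.Fin.Properties using (toℕ-injective; toℕ<n; toℕ-fromℕ<; fromℕ<-toℕ)
open import Data.Fin.Permutation using (Permutation′; _⟨$⟩ʳ_)
open import Data.Product using (_,_)
open import Data.Sum using (inj₁; inj₂)
open import Data.Empty using (⊥-elim)
open import Function using (_∘_)
open import Function.Bundles using (Injection)
open import Function.Properties.Inverse using (↔⇒↣)
open import Relation.Nullary using (¬_; yes; no)
open import Relation.Binary.Definitions using (tri<; tri≈; tri>)
open import Relation.Binary.PropositionalEquality
  using (_≡_; _≢_; refl; sym; trans; cong; subst; module ≡-Reasoning)

adjSwap : ℕ → ℕ → ℕ
adjSwap zero    zero              = 1
adjSwap zero    (suc zero)        = 0
adjSwap zero    x@(suc (suc _))   = x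
adjSwap (suc a) zero              = 0
adjSwap (suc a) (suc x)           = suc (adjSwap a x)

adjSwap-self : ∀ a → adjSwap a a ≡ suc a
adjSwap-self zero    = refl
adjSwap-self (suc a) = cong suc (adjSwap-self a)

adjSwap-suc : ∀ a → adjSwap a (suc a) ≡ a
adjSwap-suc zero    = refl
adjSwap-suc (suc a) = cong suc (adjSwap-suc a)

adjSwap-fixes : ∀ a x → x ≢ a → x ≢ suc a → adjSwap a x ≡ x
adjSwap-fixes zero    zero             x≢a _     = ⊥-elim (x≢a refl)
adjSwap-fixes zero    (suc zero)       _   x≢1+a = ⊥-elim (x≢1+a refl)
adjSwap-fixes zero    (suc (suc x))    _   _     = refl
adjSwap-fixes (suc a) zero             _   _     = refl
adjSwap-fixes (suc a) (suc x)          x≢a x≢1+a =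
  cong suc (adjSwap-fixes a x (x≢a ∘ cong suc) (x≢1+a ∘ cong suc))

adjSwap-involutive : ∀ a x → adjSwap a (adjSwap a x) ≡ x
adjSwap-involutive zero    zero          = refl
adjSwap-involutive zero    (suc zero)    = refl
adjSwap-involutive zero    (suc (suc x)) = refl
adjSwap-involutive (suc a) zero          = refl
adjSwap-involutive (suc a) (suc x)       = cong suc (adjSwap-involutive a x)

adjSwap-< : ∀ a {x n} → suc a < n → x < n → adjSwap a x < n
adjSwap-< zero    {zero}        1<n _          = 1<n
adjSwap-< zero    {suc zero}    _   (s<s _)    = z<s
adjSwap-< zero    {suc (suc x)} _   x<n        = x<n
adjSwap-< (suc a) {zero}        _   z<s        = z<s
adjSwap-< (suc a) {suc x}       a<n (s<s x<n) = s<s (adjSwap-< a (s<s⁻¹ a<n) x<n)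

adjSwap-mono-< : ∀ a {x y} → x < y → (x ≡ a → y ≢ suc a) → adjSwap a x < adjSwap a y
adjSwap-mono-< zero    {zero}        {suc zero}    _         apart = ⊥-elim (apart refl refl)
adjSwap-mono-< zero    {zero}        {suc (suc y)} _         _     = s<s z<s
adjSwap-mono-< zero    {suc _}       {suc zero}    (s<s ())  _
adjSwap-mono-< zero    {suc zero}    {suc (suc y)} _         _     = z<s
adjSwap-mono-< zero    {suc (suc x)} {suc (suc y)} x<y       _     = x<y
adjSwap-mono-< (suc a) {zero}        {suc y}       _         _     = z<s
adjSwap-mono-< (suc a) {suc x}       {suc y}       (s<s x<y) apart =
  s<s (adjSwap-mono-< a x<y λ x≡a y≡1+a → apart (cong suc x≡a) (cong suc y≡1+a))

module _ {n : ℕ} (f : (j : ℕ) → j < n → ℕ) (f<n : ∀ j p → f j p < n)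
         (f-step : ∀ j (q : suc j < n) → f j (<⇒≤ q) < f (suc j) q) where

  private
    self≤f : ∀ j p → j ≤ f j p
    self≤f zero    p = z≤n
    self≤f (suc j) q = ≤-<-trans (self≤f j _) (f-step j q)

    f≤self : ∀ k j (p : j < n) → n ≡ k + suc j → f j p ≤ j
    f≤self zero    j p refl = m<1+n⇒m≤n (f<n j p)
    f≤self (suc k) j p n≡ = m<1+n⇒m≤n (<-≤-trans fj<f1+j (f≤self k (suc j) q n≡′))
      where
      n≡′ : n ≡ k + suc (suc j)
      n≡′ = trans n≡ (sym (+-suc k (suc j)))

      q : suc j < n
      q = subst (suc j <_) (sym n≡′) (m≤n+m (suc (suc j)) k)

      fj<f1+j : f j p < f (suc j) q
      fj<f1+j = subst (λ p → f j p < f (suc j) q) (<-irrelevant _ p) (f-step j q)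

  strictlyIncreasing⇒id : ∀ j p → f j p ≡ j
  strictlyIncreasing⇒id j p =
    ≤-antisym (f≤self (n ∸ suc j) j p (sym (m∸n+n≡m p))) (self≤f j p)

⟨$⟩ʳ-injective : ∀ {n} (π : Permutation′ n) {x y} →
                 π ⟨$⟩ʳ x ≡ π ⟨$⟩ʳ y → x ≡ y
⟨$⟩ʳ-injective π = Injection.injective (↔⇒↣ π)

-- fromℕ< takes its bound irrelevantly, so val σ j p is definitionally independent of p.
val<n : ∀ {n} (σ : Permutation′ n) j p → val σ j p < n
val<n σ j p = toℕ<n (σ ⟨$⟩ʳ fromℕ< p)

val-injective : ∀ {n} (σ : Permutation′ n) {j k} (p : j < n) (q : k < n) →
                val σ j p ≡ val σ k q → j ≡ k
val-injective σ p q σj≡σk = begin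
  _                     ≡⟨ sym (toℕ-fromℕ< p) ⟩
  toℕ (fromℕ< p)        ≡⟨ cong toℕ (⟨$⟩ʳ-injective σ (toℕ-injective σj≡σk)) ⟩
  toℕ (fromℕ< q)        ≡⟨ toℕ-fromℕ< q ⟩
  _                     ∎
  where open ≡-Reasoning

toℕ-⟨$⟩ʳ : ∀ {n} (σ : Permutation′ n) (z : Fin n) →
           toℕ (σ ⟨$⟩ʳ z) ≡ val σ (toℕ z) (toℕ<n z)
toℕ-⟨$⟩ʳ σ z = cong (toℕ ∘ (σ ⟨$⟩ʳ_)) (sym (fromℕ<-toℕ z (toℕ<n z)))

¬descent⇒ascent : ∀ {n} (σ : Permutation′ n) j (q : suc j < n) →
                  ¬ HasDescentAt σ j → val σ j (<⇒≤ q) < val σ (suc j) q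
¬descent⇒ascent σ j q ¬descent with <-cmp (val σ j (<⇒≤ q)) (val σ (suc j) q)
... | tri< ascent _ _  = ascent
... | tri≈ _ σj≡σ1+j _ = ⊥-elim (1+n≢n (sym (val-injective σ (<⇒≤ q) q σj≡σ1+j)))
... | tri> _ _ descent = ⊥-elim (¬descent (q , descent))

uniqueUnitDescent⇒adjSwap : ∀ {n} (σ : Permutation′ n) i (h : suc i < n) →
                            (∀ j → HasDescentAt σ j → j ≡ i) →
                            val σ i (<⇒≤ h) ≡ suc (val σ (suc i) h) →
                            ∀ j (p : j < n) → val σ j p ≡ adjSwap i j
uniqueUnitDescent⇒adjSwap {n} σ i h unique unitDrop j p =
  subst (λ b → val σ j p ≡ adjSwap b j) a≡i (σ≡adjSwap j p)
  where
  a = val σ (suc i) h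

  τ : (j : ℕ) → j < n → ℕ
  τ j p = adjSwap a (val σ j p)

  τ<n : ∀ j p → τ j p < n
  τ<n j p = adjSwap-< a (subst (_< n) unitDrop (val<n σ i (<⇒≤ h))) (val<n σ j p)

  τ-step : ∀ j (q : suc j < n) → τ j (<⇒≤ q) < τ (suc j) q
  τ-step j q with j ≟ i
  ... | yes refl rewrite unitDrop | adjSwap-suc a | adjSwap-self a = n<1+n a
  ... | no j≢i = adjSwap-mono-< a (¬descent⇒ascent σ j q (j≢i ∘ unique j)) apart
    where
    apart : val σ j (<⇒≤ q) ≡ a → val σ (suc j) q ≢ suc a
    apart σj≡a σ1+j≡1+a = <-asym (≤-reflexive (sym j≡1+i)) (≤-reflexive 1+j≡i)
      where
      j≡1+i : j ≡ suc i
      j≡1+i = val-injective σ (<⇒≤ q) h σj≡a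

      1+j≡i : suc j ≡ i
      1+j≡i = val-injective σ q (<⇒≤ h) (trans σ1+j≡1+a (sym unitDrop))

  σ≡adjSwap : ∀ j p → val σ j p ≡ adjSwap a j
  σ≡adjSwap j p =
    trans (sym (adjSwap-involutive a _)) (cong (adjSwap a) (strictlyIncreasing⇒id τ τ<n τ-step j p))

  a≡i : a ≡ i
  a≡i = begin
    a                         ≡⟨ sym (adjSwap-suc a) ⟩
    adjSwap a (suc a)         ≡⟨ cong (adjSwap a) (trans (sym unitDrop) (σ≡adjSwap i (<⇒≤ h))) ⟩
    adjSwap a (adjSwap a i)   ≡⟨ adjSwap-involutive a i ⟩
    i                         ∎
    where open ≡-Reasoning

square-not-transposition : ∀ {n} (π : Permutation′ n) (u : Fin n) → square π ⟨$⟩ʳ u ≢ u →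
                           ¬ (∀ z → z ≢ u → z ≢ square π ⟨$⟩ʳ u → square π ⟨$⟩ʳ z ≡ z)
square-not-transposition π u moved fixesRest =
  moved (⟨$⟩ʳ-injective π (fixesRest (π ⟨$⟩ʳ u) πu≢u πu≢π²u))
  where
  πu≢u : π ⟨$⟩ʳ u ≢ u
  πu≢u πu≡u = moved (trans (cong (π ⟨$⟩ʳ_) πu≡u) πu≡u)

  πu≢π²u : π ⟨$⟩ʳ u ≢ square π ⟨$⟩ʳ u
  πu≢π²u πu≡π²u = πu≢u (sym (⟨$⟩ʳ-injective π πu≡π²u))

square≢adjSwap : ∀ {n} (π : Permutation′ n) i → suc i < n →
                 ¬ (∀ j p → val (square π) j p ≡ adjSwap i j)
square≢adjSwap π i h σ≡adjSwap = square-not-transposition π u moved fixesRest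
  where
  σ = square π
  u = fromℕ< (<⇒≤ h)

  toℕ-u : toℕ u ≡ i
  toℕ-u = toℕ-fromℕ< (<⇒≤ h)

  σ-adjSwap : ∀ z → toℕ (σ ⟨$⟩ʳ z) ≡ adjSwap i (toℕ z)
  σ-adjSwap z = trans (toℕ-⟨$⟩ʳ σ z) (σ≡adjSwap (toℕ z) (toℕ<n z))

  toℕ-σu : toℕ (σ ⟨$⟩ʳ u) ≡ suc i
  toℕ-σu = trans (σ-adjSwap u) (trans (cong (adjSwap i) toℕ-u) (adjSwap-self i))

  moved : σ ⟨$⟩ʳ u ≢ u
  moved σu≡u = 1+n≢n (trans (sym toℕ-σu) (trans (cong toℕ σu≡u) toℕ-u))

  fixesRest : ∀ z → z ≢ u → z ≢ σ ⟨$⟩ʳ u → σ ⟨$⟩ʳ z ≡ z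
  fixesRest z z≢u z≢σu = toℕ-injective (trans (σ-adjSwap z) (adjSwap-fixes i (toℕ z)
    (λ z≡i → z≢u (toℕ-injective (trans z≡i (sym toℕ-u))))
    (λ z≡1+i → z≢σu (toℕ-injective (trans z≡1+i (sym toℕ-σu))))))

lemma4p6 : ∀ n (π : Permutation′ n) (i : ℕ) →
    UniqueDescentAt (square π) i →
    (h : suc i < n) →
    val (square π) i (<-trans (n<1+n i) h) ≥ val (square π) (suc i) h + 2
lemma4p6 n π i ((_ , drop) , unique) h with m≤n⇒m<n∨m≡n drop
... | inj₁ drop≥2 = subst (_≤ val (square π) i (<⇒≤ h)) (+-comm 2 _) drop≥2
... | inj₂ drop≡1 =
  ⊥-elim (square≢adjSwap π i h (uniqueUnitDescent⇒adjSwap (square π) i h unique (sym drop≡1)))
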